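{- For every $x\in\mathbb{N}$, $F(x)\notin\{2+3m: m\in\mathbb{N}_0\}$.
   Context: $\mathbb{N}=\{1,2,3,\dots\}$, $\mathbb{N}_0=\{0\}\cup\mathbb{N}$, $\mathbb{O}$ the odd positive integers. The accelerated Collatz map $\widetilde{C}:\mathbb{O}\to\mathbb{O}$ is $\widetilde{C}(n)=(3n+1)/2^j$ where $2^j$ is the largest power of $2$ dividing $3n+1$. Let $g:\mathbb{O}\to\mathbb{N}$, $g(n)=(n+1)/2$, with inverse $g^{ -1}(x)=2x-1$. Define $F:\mathbb{N}\to\mathbb{N}$ by $F(x)=g(\widetilde{C}(g^{ -1}(x)))$. -}

module Defs where

open import Data.Nat using (ℕ; zero; suc; _+_; _*_; _∸_; _%_; _/_)

-- Odd part of a positive natural: divide out 2 while even.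
-- `oddPartAux fuel m` halves at most `fuel` times; fuel = m suffices
-- for every m ≥ 1 (each halving at least halves m), so
-- `oddPart m` is the largest odd divisor of m for m ≥ 1.
oddPartAux : ℕ → ℕ → ℕ
oddPartAux zero    m = m
oddPartAux (suc f) m with m % 2
... | zero = oddPartAux f (m / 2)
... | suc _ = m

oddPart : ℕ → ℕ
oddPart m = oddPartAux m m

Ctilde : ℕ → ℕ
Ctilde n = oddPart (3 * n + 1)

g : ℕ → ℕ
g n = (n + 1) / 2

gInv : ℕ → ℕ
gInv x = 2 * x ∸ 1

F : ℕ → ℕ
F x = g (Ctilde (gInv x))

-- Halving an even number neither creates divisibility by 3 nor destroys
-- positivity, so the odd part y of 3n + 1 is odd and prime to 3.  Writing
-- y = 1 + 2q gives g y = q + 1; if this were 2 + 3m then y = 3 (1 + 2m).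
module Submission where

open import Defs
open import Data.Nat using (ℕ; zero; suc; _+_; _*_; _/_; _%_; _≤_; _≥_; z≤n; s≤s)
open import Data.Nat.Properties using (+-comm; m≤n+m; ≤-refl; ≤-pred; ≤-trans; suc-injective)
open import Data.Nat.DivMod using (m≡m%n+[m/n]*n; m%n<n; m/n<m; m*n/n≡m)
open import Data.Nat.Divisibility using (_∣_; divides; ∣-trans; m∣m*n; ∣m+n∣m⇒∣n; ∣⇒≤)
open import Data.Nat.Tactic.RingSolver using (solve-∀)
open import Data.Product using (∃-syntax; _,_)
open import Relation.Binary.PropositionalEquality using (_≡_; sym; trans; cong; subst; module ≡-Reasoning)
open import Relation.Nullary using (¬_)

n≡n%2+[n/2]*2 : ∀ n → n ≡ n % 2 + n / 2 * 2
n≡n%2+[n/2]*2 n = m≡m%n+[m/n]*n n 2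

even⇒≡[n/2]*2 : ∀ {n} → n % 2 ≡ 0 → n ≡ n / 2 * 2
even⇒≡[n/2]*2 {n} even = trans (n≡n%2+[n/2]*2 n) (cong (_+ n / 2 * 2) even)

odd⇒≡1+[n/2]*2 : ∀ {n} → n % 2 ≡ 1 → n ≡ 1 + n / 2 * 2
odd⇒≡1+[n/2]*2 {n} odd = trans (n≡n%2+[n/2]*2 n) (cong (_+ n / 2 * 2) odd)

oddPartAux-pres-∤ : ∀ {d} fuel m → ¬ d ∣ m → ¬ d ∣ oddPartAux fuel m
oddPartAux-pres-∤ zero    m d∤m = d∤m
oddPartAux-pres-∤ (suc f) m d∤m with m % 2 in even
... | suc _ = d∤m
... | zero  = oddPartAux-pres-∤ f (m / 2) d∤m/2
  where
  d∤m/2 : ¬ _ ∣ m / 2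
  d∤m/2 d∣m/2 = d∤m (subst (_ ∣_) (sym (even⇒≡[n/2]*2 even)) (∣-trans d∣m/2 (m∣m*n 2)))

oddPartAux-odd : ∀ fuel m → 1 ≤ m → m ≤ fuel → oddPartAux fuel m % 2 ≡ 1
oddPartAux-odd zero    (suc _) _ ()
oddPartAux-odd (suc f) m 1≤m m≤1+f with m % 2 in parity | m%n<n m 2
... | suc zero    | _               = parity
... | suc (suc _) | s≤s (s≤s ())
oddPartAux-odd (suc f) (suc m) _ m≤1+f | zero | _ =
  oddPartAux-odd f (suc m / 2) 1≤m/2 (≤-pred (≤-trans (m/n<m (suc m) 2 (s≤s (s≤s z≤n))) m≤1+f))
  where
  1≤m/2 : 1 ≤ suc m / 2
  1≤m/2 with suc m / 2 | even⇒≡[n/2]*2 {suc m} parity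
  ... | suc _ | _ = s≤s z≤n

oddPart-pres-∤ : ∀ {d} m → ¬ d ∣ m → ¬ d ∣ oddPart m
oddPart-pres-∤ m = oddPartAux-pres-∤ m m

oddPart-odd : ∀ m → 1 ≤ m → oddPart m % 2 ≡ 1
oddPart-odd m 1≤m = oddPartAux-odd m m 1≤m ≤-refl

3∤3n+1 : ∀ n → ¬ 3 ∣ 3 * n + 1
3∤3n+1 n 3∣3n+1 with ∣⇒≤ (∣m+n∣m⇒∣n 3∣3n+1 (m∣m*n n))
... | s≤s ()

g[1+q*2]≡1+q : ∀ q → g (1 + q * 2) ≡ suc q
g[1+q*2]≡1+q q = trans (cong (_/ 2) (+-comm (1 + q * 2) 1)) (m*n/n≡m (suc q) 2)

odd∧g≡2+3k⇒3∣ : ∀ {y} k → y % 2 ≡ 1 → g y ≡ 2 + 3 * k → 3 ∣ y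
odd∧g≡2+3k⇒3∣ {y} k odd gy≡2+3k = divides (1 + 2 * k) (begin
  y                   ≡⟨ y≡1+q*2 ⟩
  1 + q * 2           ≡⟨ cong (λ z → 1 + z * 2) q≡1+3k ⟩
  1 + (1 + 3 * k) * 2 ≡⟨ regroup k ⟩
  (1 + 2 * k) * 3     ∎)
  where
  open ≡-Reasoning
  regroup : ∀ k → 1 + (1 + 3 * k) * 2 ≡ (1 + 2 * k) * 3
  regroup = solve-∀
  q : ℕ
  q = y / 2
  y≡1+q*2 : y ≡ 1 + q * 2
  y≡1+q*2 = odd⇒≡1+[n/2]*2 odd
  q≡1+3k : q ≡ 1 + 3 * k
  q≡1+3k = suc-injective (begin
    suc q         ≡⟨ sym (g[1+q*2]≡1+q q) ⟩
    g (1 + q * 2) ≡⟨ cong g (sym y≡1+q*2) ⟩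
    g y           ≡⟨ gy≡2+3k ⟩
    2 + 3 * k     ∎)

-- The hypothesis x ≥ 1 is not needed: F 0 = 1 by the junk value gInv 0 = 0.
lemma12 : (x : ℕ) → x ≥ 1 → ¬ (∃[ m ] F x ≡ 2 + 3 * m)
lemma12 x _ (m , Fx≡2+3m) =
  oddPart-pres-∤ (3 * n + 1) (3∤3n+1 n)
    (odd∧g≡2+3k⇒3∣ m (oddPart-odd (3 * n + 1) (m≤n+m 1 (3 * n))) Fx≡2+3m)
  where
  n : ℕ
  n = gInv x
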